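{- For integers $\Delta\ge 2$ and $D\ge 3$, there exists a graph $G$ of maximum degree $\Delta$ and diameter $D$ such that any deterministic algorithm must require $\Omega(D\log\Delta)$ time for the treasure hunt, irrespective of the number of pebbles placed on the nodes of $G$.
   Context: Model: $G$ is a connected undirected graph whose nodes are anonymous; at each node $v$ the incident edges carry distinct port numbers $0,1,\ldots,\deg(v)-1$, assigned arbitrarily. A mobile agent starts at a node $s$ and must find a stationary treasure at an unknown node at distance $D$ from $s$; it has no prior knowledge of the graph or the treasure position. It moves deterministically, choosing a port at its current node and traversing that edge; on arriving at a node it learns the node's degree, the port through which it arrived, whether the treasure is there, and whether a pebble is there. An oracle knowing the graph, the start and the treasure position places pebbles beforehand, at most one per node, in any number. The time of treasure hunt is the number of edges traversed before the agent reaches the treasure node. The lower bound means: for any deterministic agent algorithm and any pebble placement strategy, some treasure position (at distance $D$ from the start) forces time $\Omega(D\log\Delta)$. -}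

module Defs where

open import Data.Nat using (ℕ; zero; suc; _+_; _*_; _≤_; _<_; _<?_)
open import Data.Fin using (Fin; toℕ; fromℕ<; _≟_)
open import Data.Bool using (Bool)
open import Data.Maybe using (Maybe; just; nothing)
open import Data.List using (List; []; _∷_)
open import Data.Product using (Σ; _×_; _,_; proj₁; proj₂; ∃)
open import Relation.Nullary using (¬_; yes; no; does)
open import Relation.Binary.PropositionalEquality using (_≡_; _≢_)

-- Nodes are Fin n (anonymous to the agent: it never sees the index).

record PGraph : Set where
  field
    n        : ℕ
    deg      : Fin n → ℕ
  PortEnd : Set
  PortEnd = Σ (Fin n) (λ v → Fin (deg v))
  field
    other    : PortEnd → PortEnd
    involutive : ∀ e → other (other e) ≡ e
    loopless   : ∀ v p → proj₁ (other (v , p)) ≢ v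
    simple     : ∀ v p q → proj₁ (other (v , p)) ≡ proj₁ (other (v , q)) → p ≡ q

open PGraph public

Node : PGraph → Set
Node G = Fin (n G)

data Walk (G : PGraph) : ℕ → Node G → Node G → Set where
  here : ∀ {v} → Walk G zero v v
  step : ∀ {k u w} (p : Fin (deg G u)) →
         Walk G k (proj₁ (other G (u , p))) w → Walk G (suc k) u w

Dist : (G : PGraph) → Node G → Node G → ℕ → Set
Dist G u v d = Walk G d u v × (∀ k → k < d → ¬ Walk G k u v)

MaxDegree : PGraph → ℕ → Set
MaxDegree G Δ = (∀ v → deg G v ≤ Δ) × Σ (Node G) (λ v → deg G v ≡ Δ)

Diameter : PGraph → ℕ → Set
Diameter G D =
  (∀ u v → Σ ℕ (λ d → d ≤ D × Walk G d u v)) ×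
  Σ (Node G) (λ u → Σ (Node G) (λ v → Dist G u v D))

record Obs : Set where
  constructor obs
  field
    degree   : ℕ
    inPort   : Maybe ℕ     -- nothing at the start node
    treasure : Bool
    pebble   : Bool

-- A deterministic agent: from the full history of observations
-- (most recent first, including the current node) it chooses a port.
-- A port number ≥ degree is an invalid move: the agent halts for ever.
Algorithm : Set
Algorithm = List Obs → ℕ

Placement : PGraph → Set
Placement G = Node G → Bool

-- pebble placement strategy of the oracle (graph and start are fixed;
-- it may depend on the treasure position)
PebbleStrategy : PGraph → Set
PebbleStrategy G = Node G → Placement G

observe : (G : PGraph) → (t : Node G) → Placement G → Node G → Maybe ℕ → Obs
observe G t peb v ip = obs (deg G v) ip (does (v ≟ t)) (peb v)

moveStep : (G : PGraph) → (t : Node G) → Placement G → Algorithm →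
           Node G × List Obs → Maybe (Node G × List Obs)
moveStep G t peb A (v , h) with A h <? deg G v
... | yes lt =
  let e = other G (v , fromℕ< lt)
  in just (proj₁ e , (observe G t peb (proj₁ e) (just (toℕ (proj₂ e))) ∷ h))
... | no _ = nothing

run : (G : PGraph) → (s t : Node G) → Placement G → Algorithm →
      ℕ → Maybe (Node G × List Obs)
run G s t peb A zero = just (s , (observe G t peb s nothing ∷ []))
run G s t peb A (suc k) with run G s t peb A k
... | just st = moveStep G t peb A st
... | nothing = nothing

-- The graph is a broom: a path of ⌈D/2⌉ edges from the start, ending at the root of a complete
-- (Δ-1)-ary tree of depth m = ⌊D/2⌋, whose (Δ-1)^m leaves are the candidate treasures, all at
-- distance D. Until it first reaches the treasure, the agent sees only degrees, ports and pebble
-- bits, and degrees and ports do not depend on the treasure; so two leaves first reached after the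
-- same number of steps with the same pebble bits on the way are the same leaf. Fewer than 2^K bit
-- strings are shorter than K, hence for K = m ⌊log₂(Δ-1)⌋ some leaf takes k ≥ K steps; also k ≥ D.
-- Since D ≤ 3m and ⌊log₂ Δ⌋ ≤ 1 + ⌊log₂(Δ-1)⌋, this gives D ⌊log₂ Δ⌋ ≤ D + 3K ≤ 4k.

module Submission where

open import Defs
open import Data.Nat using (ℕ; zero; suc; _+_; _*_; _∸_; _^_; _≤_; _<_; z≤n; s≤s; s≤s⁻¹; z<s; _≤?_; ⌊_/2⌋; ⌈_/2⌉)
open import Data.Nat.Properties hiding (_≟_)
open import Data.Nat.Logarithm using (⌊log₂_⌋; ⌊log₂⌋-mono-≤; ⌊log₂[2*b]⌋≡1+⌊log₂b⌋)
open import Data.Nat.Logarithm.Core using (⌊log2⌋)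
open import Induction.WellFounded using (Acc; acc)
open import Data.List using (List; []; _∷_; map; length; _++_; drop; lookup)
open import Data.List.Properties using (length-map; length-++; length-drop; drop-map; drop-drop; ∷-injectiveˡ)
open import Data.List.Membership.Propositional using (_∈_)
open import Data.List.Membership.Propositional.Properties using (∈-map⁺; ∈-++⁺ˡ; ∈-++⁺ʳ)
open import Data.List.Relation.Unary.Any as Any using (index)
open import Data.List.Relation.Unary.Any.Properties using (lookup-index)
open import Data.Maybe using (Maybe; just; nothing)
open import Data.Maybe.Properties using (just-injective)
open import Data.Product using (Σ; _×_; _,_; proj₁; proj₂; ∃)
open import Data.Sum using (_⊎_; inj₁; inj₂)
open import Data.Bool using (Bool; true; false)
open import Data.Fin as F using (Fin; fromℕ<; _≟_)
import Data.Fin.Properties as FP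
open import Relation.Nullary using (¬_; Dec; yes; no; contradiction)
open import Relation.Nullary.Decidable using (¬?; dec-false; decidable-stable)
open import Relation.Binary.PropositionalEquality
open import Function using (_∘_; _↔_; Inverse; mk↔ₛ′)
open import Function.Properties.Inverse using (↔-refl; ↔-sym; ↔-trans)
open import Data.Sum.Function.Propositional using (_⊎-↔_)
open import Data.Product.Function.NonDependent.Propositional using (_×-↔_)
open import Relation.Binary.PropositionalEquality.Properties using (subst-subst)

bitListsShorterThan : ℕ → List (List Bool)
bitListsShorterThan zero = []
bitListsShorterThan (suc K) =
  [] ∷ (map (true ∷_) (bitListsShorterThan K) ++ map (false ∷_) (bitListsShorterThan K))

∈-bitListsShorterThan : ∀ {K} (bs : List Bool) → length bs < K → bs ∈ bitListsShorterThan K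
∈-bitListsShorterThan {suc K} [] _ = Any.here refl
∈-bitListsShorterThan {suc K} (true ∷ bs) (s≤s lt) =
  Any.there (∈-++⁺ˡ (∈-map⁺ (true ∷_) (∈-bitListsShorterThan bs lt)))
∈-bitListsShorterThan {suc K} (false ∷ bs) (s≤s lt) =
  Any.there (∈-++⁺ʳ (map (true ∷_) (bitListsShorterThan K)) (∈-map⁺ (false ∷_) (∈-bitListsShorterThan bs lt)))

length-bitListsShorterThan : ∀ K → suc (length (bitListsShorterThan K)) ≡ 2 ^ K
length-bitListsShorterThan zero = refl
length-bitListsShorterThan (suc K) = begin
  suc (suc (length (map (true ∷_) L ++ map (false ∷_) L)))
    ≡⟨ cong (suc ∘ suc) (trans (length-++ (map (true ∷_) L))
         (cong₂ _+_ (length-map (true ∷_) L) (length-map (false ∷_) L))) ⟩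
  suc (suc (length L + length L))      ≡⟨ cong suc (sym (+-suc (length L) (length L))) ⟩
  suc (length L) + suc (length L)      ≡⟨ cong₂ _+_ ih (trans ih (sym (+-identityʳ (2 ^ K)))) ⟩
  2 ^ suc K                            ∎
  where
    open ≡-Reasoning
    L = bitListsShorterThan K
    ih = length-bitListsShorterThan K

injection-into-shortBitLists : ∀ {N K} (f : Fin N → List Bool) →
  (∀ {i j} → f i ≡ f j → i ≡ j) → (∀ i → length (f i) < K) → N < 2 ^ K
injection-into-shortBitLists {N} {K} f f-injective short =
  subst (N <_) (length-bitListsShorterThan K) (s≤s (FP.injective⇒≤ position-injective))
  where
    position : Fin N → Fin (length (bitListsShorterThan K))
    position i = index (∈-bitListsShorterThan (f i) (short i))
    position-injective : ∀ {i j} → position i ≡ position j → i ≡ j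
    position-injective {i} {j} eq = f-injective (begin
      f i                                         ≡⟨ lookup-index (∈-bitListsShorterThan (f i) (short i)) ⟩
      lookup (bitListsShorterThan K) (position i) ≡⟨ cong (lookup (bitListsShorterThan K)) eq ⟩
      lookup (bitListsShorterThan K) (position j) ≡⟨ lookup-index (∈-bitListsShorterThan (f j) (short j)) ⟨
      f j                                         ∎)
      where open ≡-Reasoning

map-drop-suc : ∀ {A B : Set} (f : A → B) e (xs : List A) → map f (drop (suc e) xs) ≡ drop e (map f (drop 1 xs))
map-drop-suc f e xs = trans (cong (map f) (sym (drop-drop 1 e xs))) (sym (drop-map e (drop 1 xs)))

map-drop-cong : ∀ {A B : Set} (f : A → B) {d} {xs ys : List A} → 0 < d →
  map f (drop 1 xs) ≡ map f (drop 1 ys) → map f (drop d xs) ≡ map f (drop d ys)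
map-drop-cong f {suc e} {xs} {ys} _ eq =
  trans (map-drop-suc f e xs) (trans (cong (drop e) eq) (sym (map-drop-suc f e ys)))

Fin1-unique : ∀ {k} → k ≡ 1 → (a a′ : Fin k) → a ≡ a′
Fin1-unique refl F.zero F.zero = refl

walk-snoc : ∀ {G k u v} → Walk G k u v → (p : Fin (deg G v)) → Walk G (suc k) u (proj₁ (other G (v , p)))
walk-snoc here p = step p here
walk-snoc (step q w) p = step q (walk-snoc w p)

walk-reverse : ∀ {G k u v} → Walk G k u v → Walk G k v u
walk-reverse here = here
walk-reverse {G} {u = u} (step p w) =
  subst (Walk G _ _) (cong proj₁ (involutive G (u , p))) (walk-snoc (walk-reverse w) (proj₂ (other G (u , p))))

walk-++ : ∀ {G k l u v w} → Walk G k u v → Walk G l v w → Walk G (k + l) u w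
walk-++ here w₂ = w₂
walk-++ (step p w₁) w₂ = step p (walk-++ w₁ w₂)

walk-lipschitz : ∀ {G} (f : Node G → ℕ) → (∀ v p → f (proj₁ (other G (v , p))) ≤ suc (f v)) →
  ∀ {k u v} → Walk G k u v → f v ≤ k + f u
walk-lipschitz f f-step here = ≤-refl
walk-lipschitz f f-step {suc k} {u} (step p w) =
  ≤-trans (walk-lipschitz f f-step w) (≤-trans (+-monoʳ-≤ k (f-step u p)) (≤-reflexive (+-suc k (f u))))

module Execution (G : PGraph) (A : Algorithm) where

  target : ∀ v → Fin (deg G v) → Node G
  target v p = proj₁ (other G (v , p))

  observe-cong : ∀ {t pt t′ pt′ v ip} → v ≢ t → v ≢ t′ → pt v ≡ pt′ v →
    observe G t pt v ip ≡ observe G t′ pt′ v ip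
  observe-cong v≢t v≢t′ same-pebble =
    cong₂ (obs _ _) (trans (dec-false (_ ≟ _) v≢t) (sym (dec-false (_ ≟ _) v≢t′))) same-pebble

  moveStep-view : ∀ v h →
    (∀ t pt → moveStep G t pt A (v , h) ≡ nothing) ⊎
    Σ (Fin (deg G v)) λ p → Σ ℕ λ ip → ∀ t pt →
      moveStep G t pt A (v , h) ≡ just (target v p , observe G t pt (target v p) (just ip) ∷ h)
  moveStep-view v h with A h <? deg G v
  ... | yes lt = inj₂ (fromℕ< lt , _ , λ t pt → refl)
  ... | no _ = inj₁ λ t pt → refl

  moveStep-just : ∀ {t pt v h w h′} → moveStep G t pt A (v , h) ≡ just (w , h′) →
    Σ (Fin (deg G v)) λ p → Σ ℕ λ ip → w ≡ target v p × h′ ≡ observe G t pt w (just ip) ∷ h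
  moveStep-just {t} {pt} {v} {h} eq with moveStep-view v h
  ... | inj₁ halts = contradiction (trans (sym (halts t pt)) eq) λ ()
  ... | inj₂ (p , ip , moves) with just-injective (trans (sym (moves t pt)) eq)
  ...   | refl = p , ip , refl , refl

  moveStep-target-agree : ∀ {t pt t′ pt′ st w h w′ h′} →
    moveStep G t pt A st ≡ just (w , h) → moveStep G t′ pt′ A st ≡ just (w′ , h′) → w ≡ w′
  moveStep-target-agree {t} {pt} {t′} {pt′} {v , h} eq eq′ with moveStep-view v h
  ... | inj₁ halts = contradiction (trans (sym (halts t pt)) eq) λ ()
  ... | inj₂ (_ , _ , moves) =
    trans (cong proj₁ (just-injective (trans (sym eq) (moves t pt))))
          (cong proj₁ (just-injective (trans (sym (moves t′ pt′)) eq′)))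

  run-suc : ∀ {s t pt} k {st} → run G s t pt A k ≡ just st → run G s t pt A (suc k) ≡ moveStep G t pt A st
  run-suc {s} {t} {pt} k eq with run G s t pt A k
  run-suc k refl | just _ = refl

  run-suc-inv : ∀ {s t pt} k {st′} → run G s t pt A (suc k) ≡ just st′ →
    Σ (Node G × List Obs) λ st → run G s t pt A k ≡ just st × moveStep G t pt A st ≡ just st′
  run-suc-inv {s} {t} {pt} k eq with run G s t pt A k
  ... | just st = st , refl , eq

  run-walk : ∀ {s t pt} k {v h} → run G s t pt A k ≡ just (v , h) → Walk G k s v
  run-walk zero refl = here
  run-walk (suc k) eq with run-suc-inv k eq
  ... | _ , eq₀ , mv with moveStep-just mv
  ...   | p , _ , refl , refl = walk-snoc (run-walk k eq₀) p

  length-run : ∀ {s t pt} k {v h} → run G s t pt A k ≡ just (v , h) → length h ≡ suc k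
  length-run zero refl = refl
  length-run (suc k) eq with run-suc-inv k eq
  ... | _ , eq₀ , mv with moveStep-just mv
  ...   | _ , _ , _ , refl = cong suc (length-run k eq₀)

  run-drop : ∀ {s t pt} e k {v h} → run G s t pt A (e + k) ≡ just (v , h) →
    Σ (Node G) λ u → run G s t pt A k ≡ just (u , drop e h)
  run-drop zero k eq = _ , eq
  run-drop (suc e) k eq with run-suc-inv (e + k) eq
  ... | _ , eq₀ , mv with moveStep-just mv
  ...   | _ , _ , _ , refl = run-drop e k eq₀

  run-before : ∀ {s t pt j v h k} → k ≤ j → run G s t pt A j ≡ just (v , h) →
    Σ (Node G) λ u → run G s t pt A k ≡ just (u , drop (j ∸ k) h)
  run-before {s} {t} {pt} {j} {k = k} k≤j eq = run-drop (j ∸ k) k (trans (cong (run G s t pt A) (m∸n+n≡m k≤j)) eq)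

  history-before : ∀ {s t pt j v h k u h₀} → k ≤ j → run G s t pt A j ≡ just (v , h) →
    run G s t pt A k ≡ just (u , h₀) → h₀ ≡ drop (j ∸ k) h
  history-before k≤j eq eq₀ = cong proj₂ (just-injective (trans (sym eq₀) (proj₂ (run-before k≤j eq))))

module TreasureHunt (G : PGraph) (s : Node G) (A : Algorithm) (P : PebbleStrategy G) where
  open Execution G A

  hunt : Node G → ℕ → Maybe (Node G × List Obs)
  hunt t = run G s t (P t) A

  ArrivesAt : Node G → ℕ → Set
  ArrivesAt t k = Σ (List Obs) λ h → hunt t k ≡ just (t , h)

  arrivesAt? : ∀ t k → Dec (ArrivesAt t k)
  arrivesAt? t k with hunt t k
  ... | nothing = no λ ()
  ... | just (v , h) with v ≟ t
  ...   | yes refl = yes (h , refl)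
  ...   | no v≢t = no λ (_ , eq) → v≢t (cong proj₁ (just-injective eq))

  arrivesBefore? : ∀ t K → Dec (∃ λ k → k < K × ArrivesAt t k)
  arrivesBefore? t = anyUpTo? (arrivesAt? t)

  record FirstArrival (t : Node G) : Set where
    field
      time    : ℕ
      history : List Obs
      arrives : hunt t time ≡ just (t , history)
      first   : ∀ k → k < time → ¬ ArrivesAt t k
  open FirstArrival

  first-arrival : ∀ {t} K → (∃ λ k → k < K × ArrivesAt t k) → Σ (FirstArrival t) λ a → time a < K
  first-arrival {t} (suc K) (k , k<1+K , h , eq) with arrivesBefore? t K
  ... | yes earlier = let a , a<K = first-arrival K earlier in a , m<n⇒m<1+n a<K
  ... | no none = record { time = k ; history = h ; arrives = eq ; first = earliest } , k<1+K
    where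
      earliest : ∀ l → l < k → ¬ ArrivesAt t l
      earliest l l<k arr = none (l , <-≤-trans l<k (s≤s⁻¹ k<1+K) , arr)

  pebbles : List Obs → List Bool
  pebbles = map Obs.pebble

  -- The observation at the treasure itself is dropped: it is the one place where two hunts may differ.
  pebbleCode : ∀ {t} → FirstArrival t → List Bool
  pebbleCode a = pebbles (drop 1 (history a))

  length-pebbleCode : ∀ {t} (a : FirstArrival t) → length (pebbleCode a) ≡ time a
  length-pebbleCode a = begin
    length (pebbles (drop 1 (history a))) ≡⟨ length-map Obs.pebble (drop 1 (history a)) ⟩
    length (drop 1 (history a))           ≡⟨ length-drop 1 (history a) ⟩
    length (history a) ∸ 1                ≡⟨ cong (_∸ 1) (length-run (time a) (arrives a)) ⟩
    time a                                ∎
    where open ≡-Reasoning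

  module SameCode {t t′ j h h′}
      (arr : hunt t j ≡ just (t , h)) (arr′ : hunt t′ j ≡ just (t′ , h′))
      (none-before : ∀ k → k < j → ¬ ArrivesAt t k) (none-before′ : ∀ k → k < j → ¬ ArrivesAt t′ k)
      (same-code : pebbles (drop 1 h) ≡ pebbles (drop 1 h′)) where

    agree-at : ∀ {k w ip h₀} → k < j →
      hunt t k ≡ just (w , observe G t (P t) w ip ∷ h₀) →
      hunt t′ k ≡ just (w , observe G t′ (P t′) w ip ∷ h₀) →
      hunt t k ≡ hunt t′ k
    agree-at {k} {w} {ip} {h₀} k<j eq eq′ =
      trans eq (trans (cong (λ o → just (w , o ∷ h₀)) (observe-cong {pt = P t} {pt′ = P t′} w≢t w≢t′ same-pebble)) (sym eq′))
      where
        w≢t : w ≢ t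
        w≢t refl = none-before k k<j (_ , eq)
        w≢t′ : w ≢ t′
        w≢t′ refl = none-before′ k k<j (_ , eq′)
        same-pebble : P t w ≡ P t′ w
        same-pebble = ∷-injectiveˡ (begin
          pebbles (observe G t (P t) w ip ∷ h₀)   ≡⟨ cong pebbles (history-before (<⇒≤ k<j) arr eq) ⟩
          pebbles (drop (j ∸ k) h)                ≡⟨ map-drop-cong Obs.pebble (m<n⇒0<n∸m k<j) same-code ⟩
          pebbles (drop (j ∸ k) h′)               ≡⟨ cong pebbles (history-before (<⇒≤ k<j) arr′ eq′) ⟨
          pebbles (observe G t′ (P t′) w ip ∷ h₀) ∎)
          where open ≡-Reasoning

    step-agree : ∀ {k v h₀} → suc k < j →
      hunt t (suc k) ≡ moveStep G t (P t) A (v , h₀) → hunt t′ (suc k) ≡ moveStep G t′ (P t′) A (v , h₀) →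
      hunt t (suc k) ≡ hunt t′ (suc k)
    step-agree {v = v} {h₀} k<j eq eq′ with moveStep-view v h₀
    ... | inj₁ halts = trans eq (trans (halts t (P t)) (sym (trans eq′ (halts t′ (P t′)))))
    ... | inj₂ (_ , _ , moves) = agree-at k<j (trans eq (moves t (P t))) (trans eq′ (moves t′ (P t′)))

    hunts-agree : ∀ k → k < j → hunt t k ≡ hunt t′ k
    hunts-agree zero 0<j = agree-at 0<j refl refl
    hunts-agree (suc k) k<j =
      let _ , eq = run-before (<⇒≤ k<j′) arr
      in step-agree k<j (run-suc k eq) (run-suc k (trans (sym (hunts-agree k k<j′)) eq))
      where k<j′ = <-trans (n<1+n k) k<j

  same-code⇒same-treasure : ∀ {t t′ j h h′} →
    hunt t j ≡ just (t , h) → hunt t′ j ≡ just (t′ , h′) →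
    (∀ k → k < j → ¬ ArrivesAt t k) → (∀ k → k < j → ¬ ArrivesAt t′ k) →
    pebbles (drop 1 h) ≡ pebbles (drop 1 h′) → t ≡ t′
  same-code⇒same-treasure {j = zero} refl refl _ _ _ = refl
  same-code⇒same-treasure {j = suc k} arr arr′ none-before none-before′ same-code =
    let _ , eq = run-before (n≤1+n k) arr
        eq′ = trans (sym (SameCode.hunts-agree arr arr′ none-before none-before′ same-code k (n<1+n k))) eq
    in moveStep-target-agree (trans (sym (run-suc k eq)) arr) (trans (sym (run-suc k eq′)) arr′)

  pebbleCode-injective : ∀ {t t′} (a : FirstArrival t) (a′ : FirstArrival t′) → pebbleCode a ≡ pebbleCode a′ → t ≡ t′
  pebbleCode-injective {t} {t′} a a′ same-code = go same-time (arrives a′) (first a′)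
    where
      same-time : time a ≡ time a′
      same-time = trans (sym (length-pebbleCode a)) (trans (cong length same-code) (length-pebbleCode a′))
      go : ∀ {j} → time a ≡ j → hunt t′ j ≡ just (t′ , history a′) → (∀ k → k < j → ¬ ArrivesAt t′ k) → t ≡ t′
      go refl arr′ none-before′ = same-code⇒same-treasure (arrives a) arr′ (first a) none-before′ same-code

  slow-treasure : ∀ {N} K (treasure : Fin N → Node G) → (∀ {i j} → treasure i ≡ treasure j → i ≡ j) → 2 ^ K ≤ N →
    Σ (Fin N) λ i → ∀ k h → hunt (treasure i) k ≡ just (treasure i , h) → K ≤ k
  slow-treasure K treasure treasure-injective 2^K≤N with FP.any? (λ i → ¬? (arrivesBefore? (treasure i) K))
  ... | yes (i , never) = i , λ k h eq → ≮⇒≥ λ k<K → never (k , k<K , h , eq)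
  ... | no ¬slow = contradiction 2^K≤N (<⇒≱ (injection-into-shortBitLists code code-injective code-short))
    where
      arrival : ∀ i → Σ (FirstArrival (treasure i)) λ a → time a < K
      arrival i = first-arrival K (decidable-stable (arrivesBefore? (treasure i) K) λ never → ¬slow (i , never))
      code : Fin _ → List Bool
      code i = pebbleCode (proj₁ (arrival i))
      code-injective : ∀ {i j} → code i ≡ code j → i ≡ j
      code-injective {i} {j} eq = treasure-injective (pebbleCode-injective (proj₁ (arrival i)) (proj₁ (arrival j)) eq)
      code-short : ∀ i → length (code i) < K
      code-short i = subst (_< K) (sym (length-pebbleCode (proj₁ (arrival i)))) (proj₂ (arrival i))

record PortGraphOn (X : Set) : Set where
  field
    degree     : X → ℕ
    opposite   : Σ X (Fin ∘ degree) → Σ X (Fin ∘ degree)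
    involutive : ∀ e → opposite (opposite e) ≡ e
    loopless   : ∀ x p → proj₁ (opposite (x , p)) ≢ x
    simple     : ∀ x p q → proj₁ (opposite (x , p)) ≡ proj₁ (opposite (x , q)) → p ≡ q

module Relabel {X : Set} (𝒢 : PortGraphOn X) {n : ℕ} (iso : X ↔ Fin n) where
  open PortGraphOn 𝒢 using (degree; opposite)
  open Inverse iso using (to; from; strictlyInverseˡ; strictlyInverseʳ)

  End : Set
  End = Σ (Fin n) (Fin ∘ degree ∘ from)

  -- The ports at  to x  live in  Fin (degree (from (to x))), equal to  Fin (degree x)  only propositionally.
  relabelPort : ∀ {x y} → from y ≡ x → Fin (degree x) → Fin (degree (from y))
  relabelPort eq = subst Fin (cong degree (sym eq))

  toEnd : Σ X (Fin ∘ degree) → End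
  toEnd (x , q) = to x , relabelPort (strictlyInverseʳ x) q

  opposite-relabelPort : ∀ {x y} (eq : from y ≡ x) q → opposite (from y , relabelPort eq q) ≡ opposite (x , q)
  opposite-relabelPort refl q = refl

  end-≡ : ∀ {i j} (e : j ≡ i) (q : Fin (degree (from j))) (p : Fin (degree (from i))) →
    subst Fin (cong (degree ∘ from) e) q ≡ p → _≡_ {A = End} (j , q) (i , p)
  end-≡ refl q p refl = refl

  toEnd-from : ∀ i p → toEnd (from i , p) ≡ (i , p)
  toEnd-from i p = end-≡ (strictlyInverseˡ i) _ p
    (trans (subst-subst (cong degree (sym (strictlyInverseʳ (from i)))) {cong (degree ∘ from) (strictlyInverseˡ i)})
           (cong (λ e → subst Fin e p) (≡-irrelevant _ refl)))

  otherEnd : End → End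
  otherEnd (i , p) = toEnd (opposite (from i , p))

  otherEnd-involutive : ∀ e → otherEnd (otherEnd e) ≡ e
  otherEnd-involutive (i , p) = begin
    toEnd (opposite (from (to x) , relabelPort (strictlyInverseʳ x) q)) ≡⟨ cong toEnd (opposite-relabelPort (strictlyInverseʳ x) q) ⟩
    toEnd (opposite (x , q))                                           ≡⟨ cong toEnd (PortGraphOn.involutive 𝒢 (from i , p)) ⟩
    toEnd (from i , p)                                                 ≡⟨ toEnd-from i p ⟩
    (i , p)                                                            ∎
    where
      open ≡-Reasoning
      x = proj₁ (opposite (from i , p))
      q = proj₂ (opposite (from i , p))

  to-injective : ∀ {x y} → to x ≡ to y → x ≡ y
  to-injective {x} {y} eq = trans (sym (strictlyInverseʳ x)) (trans (cong from eq) (strictlyInverseʳ y))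

  graph : PGraph
  graph = record
    { n          = n
    ; deg        = degree ∘ from
    ; other      = otherEnd
    ; involutive = otherEnd-involutive
    ; loopless   = λ i p eq → PortGraphOn.loopless 𝒢 (from i) p (trans (sym (strictlyInverseʳ _)) (cong from eq))
    ; simple     = λ i p q eq → PortGraphOn.simple 𝒢 (from i) p q (to-injective eq)
    }

  step-to : ∀ {k w} x (q : Fin (degree x)) → Walk graph k (to (proj₁ (opposite (x , q)))) w → Walk graph (suc k) (to x) w
  step-to {k} {w} x q W =
    step (relabelPort (strictlyInverseʳ x) q)
         (subst (λ z → Walk graph k z w) (sym (cong (to ∘ proj₁) (opposite-relabelPort (strictlyInverseʳ x) q))) W)

-- Number of children of a vertex at depth d in the broom: a path of p edges from the root,
-- continued by a complete b-ary tree of depth m.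
children : ℕ → ℕ → ℕ → ℕ → ℕ
children b (suc p) m zero    = 1
children b (suc p) m (suc d) = children b p m d
children b zero (suc m) zero    = b
children b zero (suc m) (suc d) = children b zero m d
children b zero zero d = 0

children-below : ∀ b p m d → Fin (children b p m d) → d < p + m
children-below b (suc p) m zero    _ = s≤s z≤n
children-below b (suc p) m (suc d) q = s≤s (children-below b p m d q)
children-below b zero (suc m) zero    _ = s≤s z≤n
children-below b zero (suc m) (suc d) q = s≤s (children-below b zero m d q)

children≤ : ∀ b p m d → 1 ≤ b → children b p m d ≤ b
children≤ b (suc p) m zero    1≤b = 1≤b
children≤ b (suc p) m (suc d) 1≤b = children≤ b p m d 1≤b
children≤ b zero (suc m) zero    _   = ≤-refl
children≤ b zero (suc m) (suc d) 1≤b = children≤ b zero m d 1≤b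
children≤ b zero zero d _ = z≤n

children-handle : ∀ b p m d → d < p → children b p m d ≡ 1
children-handle b (suc p) m zero    _ = refl
children-handle b (suc p) m (suc d) (s≤s d<p) = children-handle b p m d d<p

children-head : ∀ b p m j → j < m → children b p m (p + j) ≡ b
children-head b (suc p) m j j<m = children-head b p m j j<m
children-head b zero (suc m) zero    _ = refl
children-head b zero (suc m) (suc j) (s≤s j<m) = children-head b zero m j j<m

module Broom (b p m : ℕ) where

  H : ℕ
  H = p + m

  B : ℕ → ℕ
  B = children b p m

  data Address : ℕ → Set where
    root : Address 0
    _◃_  : ∀ {d} → Fin (B d) → Address d → Address (suc d)

  record Vertex (h : ℕ) : Set where
    constructor vertex
    field
      depth   : ℕ
      depth≤  : depth ≤ h
      address : Address depth
  open Vertex public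

  vertex-≡ : ∀ {h d} {l l′ : d ≤ h} {w w′ : Address d} → w ≡ w′ → vertex d l w ≡ vertex d l′ w′
  vertex-≡ {l = l} {l′} refl = cong (λ l → vertex _ l _) (≤-irrelevant l l′)

  address-injective : ∀ {h d} {l l′ : d ≤ h} {w w′ : Address d} → vertex d l w ≡ vertex d l′ w′ → w ≡ w′
  address-injective refl = refl

  ◃-injectiveˡ : ∀ {d} {a a′ : Fin (B d)} {w w′ : Address d} → a ◃ w ≡ a′ ◃ w′ → a ≡ a′
  ◃-injectiveˡ refl = refl

  #addresses : ℕ → ℕ
  #addresses zero    = 1
  #addresses (suc d) = B d * #addresses d

  address↔ : ∀ d → Address d ↔ Fin (#addresses d)
  address↔ zero = mk↔ₛ′ (λ _ → F.zero) (λ _ → root) (λ { F.zero → refl ; (F.suc ()) }) (λ { root → refl })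
  address↔ (suc d) = ↔-trans split (↔-trans (↔-refl ×-↔ address↔ d) (↔-sym FP.*↔×))
    where
      split : Address (suc d) ↔ (Fin (B d) × Address d)
      split = mk↔ₛ′ (λ { (a ◃ w) → a , w }) (λ (a , w) → a ◃ w) (λ _ → refl) (λ { (a ◃ w) → refl })

  #vertices : ℕ → ℕ
  #vertices zero    = 1
  #vertices (suc h) = #vertices h + #addresses (suc h)

  vertex↔ : ∀ h → Vertex h ↔ Fin (#vertices h)
  vertex↔ zero = mk↔ₛ′ (λ _ → F.zero) (λ _ → vertex 0 z≤n root) (λ { F.zero → refl ; (F.suc ()) })
                   (λ { (vertex 0 z≤n root) → refl ; (vertex (suc _) () _) })
  vertex↔ (suc h) = ↔-trans split (↔-trans (vertex↔ h ⊎-↔ address↔ (suc h)) (↔-sym FP.+↔⊎))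
    where
      lower : ∀ {d} → d ≤ suc h → Address d → d < suc h ⊎ d ≡ suc h → Vertex h ⊎ Address (suc h)
      lower _ w (inj₁ d<1+h) = inj₁ (vertex _ (s≤s⁻¹ d<1+h) w)
      lower _ w (inj₂ refl)  = inj₂ w
      raise : Vertex h ⊎ Address (suc h) → Vertex (suc h)
      raise (inj₁ (vertex d l w)) = vertex d (m≤n⇒m≤1+n l) w
      raise (inj₂ w)              = vertex (suc h) ≤-refl w
      lower-raise : ∀ x → lower _ (address (raise x)) (m≤n⇒m<n∨m≡n (depth≤ (raise x))) ≡ x
      lower-raise (inj₁ (vertex d l w)) with m≤n⇒m<n∨m≡n (m≤n⇒m≤1+n l)
      ... | inj₁ _    = cong inj₁ (vertex-≡ refl)
      ... | inj₂ refl = contradiction l 1+n≰n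
      lower-raise (inj₂ w) with m≤n⇒m<n∨m≡n (≤-refl {suc h})
      ... | inj₁ h<h  = contradiction h<h (<-irrefl refl)
      ... | inj₂ refl = refl
      raise-lower : ∀ {d} (l : d ≤ suc h) w c → raise (lower l w c) ≡ vertex d l w
      raise-lower _ w (inj₁ _)    = vertex-≡ refl
      raise-lower _ w (inj₂ refl) = vertex-≡ refl
      split : Vertex (suc h) ↔ (Vertex h ⊎ Address (suc h))
      split = mk↔ₛ′ (λ (vertex d l w) → lower l w (m≤n⇒m<n∨m≡n l)) raise lower-raise
                    (λ (vertex d l w) → raise-lower l w (m≤n⇒m<n∨m≡n l))

  degreeAt : ℕ → ℕ
  degreeAt zero    = B 0
  degreeAt (suc d) = suc (B (suc d))

  childPort : ∀ d → Fin (B d) → Fin (degreeAt d)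
  childPort zero    a = a
  childPort (suc d) a = F.suc a

  Port : Set
  Port = Σ (Vertex H) (Fin ∘ degreeAt ∘ depth)

  -- Port 0 of a non-root vertex leads to its parent, every other port to a child.
  opposite : Port → Port
  opposite (vertex zero _ root , q) = vertex 1 (children-below b p m 0 q) (q ◃ root) , F.zero
  opposite (vertex (suc d) l (a ◃ w) , F.zero) = vertex d (≤-trans (n≤1+n d) l) w , childPort d a
  opposite (vertex (suc d) l (a ◃ w) , F.suc q) =
    vertex (suc (suc d)) (children-below b p m (suc d) q) (q ◃ (a ◃ w)) , F.zero

  port-≡ : ∀ {d} {l l′ : d ≤ H} {w : Address d} {q} → _≡_ {A = Port} (vertex d l w , q) (vertex d l′ w , q)
  port-≡ {l = l} {l′} with ≤-irrelevant l l′
  ... | refl = refl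

  opposite-involutive : ∀ e → opposite (opposite e) ≡ e
  opposite-involutive (vertex zero _ root , q) = port-≡
  opposite-involutive (vertex (suc zero) _ (a ◃ root) , F.zero) = port-≡
  opposite-involutive (vertex (suc (suc d)) _ (a ◃ (a′ ◃ w)) , F.zero) = port-≡
  opposite-involutive (vertex (suc d) _ (a ◃ w) , F.suc q) = port-≡

  opposite-loopless : ∀ x q → proj₁ (opposite (x , q)) ≢ x
  opposite-loopless (vertex zero _ root) q ()
  opposite-loopless (vertex (suc d) _ (a ◃ w)) F.zero eq = 1+n≢n (sym (cong depth eq))
  opposite-loopless (vertex (suc d) _ (a ◃ w)) (F.suc q) eq = 1+n≢n (cong depth eq)

  opposite-simple : ∀ x q r → proj₁ (opposite (x , q)) ≡ proj₁ (opposite (x , r)) → q ≡ r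
  opposite-simple (vertex zero _ root) q r eq = ◃-injectiveˡ (address-injective eq)
  opposite-simple (vertex (suc d) _ (a ◃ w)) F.zero F.zero _ = refl
  opposite-simple (vertex (suc d) _ (a ◃ w)) F.zero (F.suc r) eq = contradiction (cong depth eq) (<⇒≢ (m<n+m d z<s))
  opposite-simple (vertex (suc d) _ (a ◃ w)) (F.suc q) F.zero eq = contradiction (cong depth (sym eq)) (<⇒≢ (m<n+m d z<s))
  opposite-simple (vertex (suc d) _ (a ◃ w)) (F.suc q) (F.suc r) eq = cong F.suc (◃-injectiveˡ (address-injective eq))

  broom : PortGraphOn (Vertex H)
  broom = record
    { degree = degreeAt ∘ depth ; opposite = opposite ; involutive = opposite-involutive
    ; loopless = opposite-loopless ; simple = opposite-simple }

  module R = Relabel broom (vertex↔ H)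
  open Inverse (vertex↔ H) using (from; strictlyInverseʳ)

  G : PGraph
  G = R.graph

  node : Vertex H → Node G
  node = Inverse.to (vertex↔ H)

  depth-opposite : ∀ x q → depth (proj₁ (opposite (x , q))) ≤ suc (depth x)
  depth-opposite (vertex zero _ root) q = ≤-refl
  depth-opposite (vertex (suc d) _ (a ◃ w)) F.zero = m≤n⇒m≤1+n (n≤1+n d)
  depth-opposite (vertex (suc d) _ (a ◃ w)) (F.suc q) = ≤-refl

  depth-walk : ∀ {k x y} → Walk G k (node x) (node y) → depth y ≤ k + depth x
  depth-walk {k} {x} {y} W = subst₂ (λ y′ x′ → depth y′ ≤ k + depth x′) (strictlyInverseʳ y) (strictlyInverseʳ x)
    (walk-lipschitz (depth ∘ from)
      (λ v q → ≤-trans (≤-reflexive (cong depth (strictlyInverseʳ _))) (depth-opposite (from v) q)) W)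

  walk-up : ∀ e j (x : Vertex H) → depth x ≡ e + j → Σ (Vertex H) λ y → depth y ≡ j × Walk G e (node x) (node y)
  walk-up zero j x eq = x , eq , here
  walk-up (suc e) j (vertex _ l (a ◃ w)) refl with walk-up e j (vertex (e + j) (≤-trans (n≤1+n _) l) w) refl
  ... | y , y-depth , W = y , y-depth , R.step-to (vertex _ l (a ◃ w)) F.zero W

  walk-up-to : ∀ (x : Vertex H) j → j ≤ depth x → Σ (Vertex H) λ y → depth y ≡ j × Walk G (depth x ∸ j) (node x) (node y)
  walk-up-to x j j≤ = walk-up (depth x ∸ j) j x (sym (m∸n+n≡m j≤))

  handle-address-unique : ∀ {d} → d ≤ p → (w w′ : Address d) → w ≡ w′
  handle-address-unique {zero} _ root root = refl
  handle-address-unique {suc d} l (a ◃ w) (a′ ◃ w′) =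
    cong₂ _◃_ (Fin1-unique (children-handle b p m d l) a a′) (handle-address-unique (≤-trans (n≤1+n d) l) w w′)

  handle-vertex-unique : ∀ (x y : Vertex H) → depth x ≡ depth y → depth x ≤ p → x ≡ y
  handle-vertex-unique (vertex d _ w) (vertex d _ w′) refl d≤p = vertex-≡ (handle-address-unique d≤p w w′)

  walk-down : ∀ (x y : Vertex H) → depth x ≤ depth y → depth x ≤ p → Walk G (depth y ∸ depth x) (node x) (node y)
  walk-down x y x≤y x≤p with walk-up-to y (depth x) x≤y
  ... | z , z-depth , W = walk-reverse
    (subst (λ v → Walk G _ (node y) (node v)) (handle-vertex-unique z x z-depth (subst (_≤ p) (sym z-depth) x≤p)) W)

  below-handle : ∀ (x : Vertex H) → depth x ∸ p ≤ m
  below-handle x = ≤-trans (∸-monoˡ-≤ p (depth≤ x)) (≤-reflexive (m+n∸m≡n p m))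

  walk-from-handle : ∀ x y → depth x ≤ p → Σ ℕ λ d → d ≤ H × Walk G d (node x) (node y)
  walk-from-handle x y x≤p with depth x ≤? depth y
  ... | yes x≤y = _ , ≤-trans (m∸n≤m _ (depth x)) (depth≤ y) , walk-down x y x≤y x≤p
  ... | no x≰y = _ , ≤-trans (m∸n≤m _ (depth y)) (depth≤ x) , walk-reverse (walk-down y x y≤x (≤-trans y≤x x≤p))
    where y≤x = <⇒≤ (≰⇒> x≰y)

  -- Two vertices below the handle meet through its lower end, at distance at most m + m ≤ H.
  walk-between : m ≤ p → ∀ x y → Σ ℕ λ d → d ≤ H × Walk G d (node x) (node y)
  walk-between m≤p x y with depth x ≤? p | depth y ≤? p
  ... | yes x≤p | _ = walk-from-handle x y x≤p
  ... | no _ | yes y≤p = let d , d≤H , W = walk-from-handle y x y≤p in d , d≤H , walk-reverse W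
  ... | no x≰p | no y≰p with walk-up-to x p (<⇒≤ (≰⇒> x≰p))
  ...   | z , z-depth , W = _ , bound , walk-++ W (subst (λ d → Walk G (depth y ∸ d) (node z) (node y)) z-depth
            (walk-down z y (subst (_≤ depth y) (sym z-depth) (<⇒≤ (≰⇒> y≰p))) (≤-reflexive z-depth)))
    where
      bound : (depth x ∸ p) + (depth y ∸ p) ≤ H
      bound = ≤-trans (+-mono-≤ (below-handle x) (below-handle y)) (+-monoˡ-≤ m m≤p)

  start : Vertex H
  start = vertex 0 z≤n root

  leaf : Fin (#addresses H) → Vertex H
  leaf i = vertex H ≤-refl (Inverse.from (address↔ H) i)

  leaf-injective : ∀ {i i′} → node (leaf i) ≡ node (leaf i′) → i ≡ i′
  leaf-injective {i} {i′} eq = trans (sym (to∘from i)) (trans (cong to (address-injective (R.to-injective eq))) (to∘from i′))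
    where open Inverse (address↔ H) using (to) renaming (strictlyInverseˡ to to∘from)

  dist-start : ∀ y → depth y ≡ H → Dist G (node start) (node y) H
  dist-start y y-depth = walk , shorter
    where
      walk : Walk G H (node start) (node y)
      walk with walk-up H 0 y (trans y-depth (sym (+-identityʳ H)))
      ... | z , z-depth , W =
        walk-reverse (subst (λ v → Walk G H (node y) (node v)) (handle-vertex-unique z start z-depth (subst (_≤ p) (sym z-depth) z≤n)) W)
      shorter : ∀ k → k < H → ¬ Walk G k (node start) (node y)
      shorter k k<H W = <⇒≱ k<H (≤-trans (≤-reflexive (sym y-depth)) (≤-trans (depth-walk W) (≤-reflexive (+-identityʳ k))))

  #addresses-handle : ∀ d → d ≤ p → #addresses d ≡ 1
  #addresses-handle zero _ = refl
  #addresses-handle (suc d) l rewrite children-handle b p m d l | #addresses-handle d (≤-trans (n≤1+n d) l) = refl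

  #addresses-head : ∀ j → j ≤ m → #addresses (p + j) ≡ b ^ j
  #addresses-head zero _ rewrite +-identityʳ p = #addresses-handle p ≤-refl
  #addresses-head (suc j) l rewrite +-suc p j | children-head b p m j l | #addresses-head j (≤-trans (n≤1+n j) l) = refl

  degree-bound : 1 ≤ b → ∀ v → deg G v ≤ suc b
  degree-bound 1≤b v with depth (from v)
  ... | zero  = m≤n⇒m≤1+n (children≤ b p m 0 1≤b)
  ... | suc d = s≤s (children≤ b p m (suc d) 1≤b)

  handle-end : Vertex H
  handle-end = vertex p (m≤m+n p m) (Inverse.from (address↔ p) (subst Fin (sym (#addresses-handle p ≤-refl)) F.zero))

  degree-handle-end : 1 ≤ p → 1 ≤ m → deg G (node handle-end) ≡ suc b
  degree-handle-end 1≤p 1≤m = trans (cong (degreeAt ∘ depth) (strictlyInverseʳ handle-end))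
    (trans (degreeAt-inner p 1≤p) (cong suc (trans (cong B (sym (+-identityʳ p))) (children-head b p m 0 1≤m))))
    where
      degreeAt-inner : ∀ d → 1 ≤ d → degreeAt d ≡ suc (B d)
      degreeAt-inner (suc d) _ = refl

  walk-any : m ≤ p → ∀ u v → Σ ℕ λ d → d ≤ H × Walk G d u v
  walk-any m≤p u v with walk-between m≤p (from u) (from v)
  ... | d , d≤H , W = d , d≤H , subst₂ (Walk G d) (to∘from u) (to∘from v) W
    where open Inverse (vertex↔ H) using () renaming (strictlyInverseˡ to to∘from)

  slow-leaf : ∀ K → 2 ^ K ≤ b ^ m → (A : Algorithm) (P : PebbleStrategy G) →
    Σ (Fin (#addresses H)) λ i → ∀ k h →
      run G (node start) (node (leaf i)) (P (node (leaf i))) A k ≡ just (node (leaf i) , h) → H ≤ k × K ≤ k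
  slow-leaf K 2^K≤b^m A P with TreasureHunt.slow-treasure G (node start) A P K (node ∘ leaf) leaf-injective
                                 (subst (2 ^ K ≤_) (sym (#addresses-head m ≤-refl)) 2^K≤b^m)
  ... | i , slow = i , λ k h arr →
    ≮⇒≥ (λ k<H → proj₂ (dist-start (leaf i) refl) k k<H (Execution.run-walk G A k arr)) , slow k h arr

2^⌊log2⌋≤ : ∀ n (rec : Acc _<_ n) → 1 ≤ n → 2 ^ ⌊log2⌋ n rec ≤ n
2^⌊log2⌋≤ (suc zero) _ _ = ≤-refl
2^⌊log2⌋≤ (suc (suc k)) (acc rs) _ = begin
  2 * 2 ^ ⌊log2⌋ (suc h) (rs (⌊n/2⌋<n (suc k))) ≤⟨ *-monoʳ-≤ 2 (2^⌊log2⌋≤ (suc h) _ (s≤s z≤n)) ⟩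
  suc h + (suc h + 0)                            ≡⟨ cong (suc h +_) (+-identityʳ (suc h)) ⟩
  suc h + suc h                                  ≡⟨ cong suc (+-suc h h) ⟩
  suc (suc (h + h))                              ≤⟨ s≤s (s≤s (+-monoʳ-≤ h (⌊n/2⌋≤⌈n/2⌉ k))) ⟩
  suc (suc (h + ⌈ k /2⌉))                        ≡⟨ cong (suc ∘ suc) (⌊n/2⌋+⌈n/2⌉≡n k) ⟩
  suc (suc k)                                    ∎
  where
    open ≤-Reasoning
    h = ⌊ k /2⌋

2^⌊log₂n⌋≤n : ∀ n → 1 ≤ n → 2 ^ ⌊log₂ n ⌋ ≤ n
2^⌊log₂n⌋≤n n = 2^⌊log2⌋≤ n _

2^[m*⌊log₂b⌋]≤b^m : ∀ b m → 1 ≤ b → 2 ^ (m * ⌊log₂ b ⌋) ≤ b ^ m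
2^[m*⌊log₂b⌋]≤b^m b m 1≤b = begin
  2 ^ (m * ⌊log₂ b ⌋)   ≡⟨ cong (2 ^_) (*-comm m ⌊log₂ b ⌋) ⟩
  2 ^ (⌊log₂ b ⌋ * m)   ≡⟨ ^-*-assoc 2 ⌊log₂ b ⌋ m ⟨
  (2 ^ ⌊log₂ b ⌋) ^ m   ≤⟨ ^-monoˡ-≤ m (2^⌊log₂n⌋≤n b 1≤b) ⟩
  b ^ m                 ∎
  where open ≤-Reasoning

⌊log₂[2+n]⌋≤1+⌊log₂[1+n]⌋ : ∀ n → ⌊log₂ (suc (suc n)) ⌋ ≤ suc ⌊log₂ (suc n) ⌋
⌊log₂[2+n]⌋≤1+⌊log₂[1+n]⌋ n =
  ≤-trans (⌊log₂⌋-mono-≤ 2+n≤2*[1+n]) (≤-reflexive (⌊log₂[2*b]⌋≡1+⌊log₂b⌋ (suc n)))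
  where
    2+n≤2*[1+n] : suc (suc n) ≤ 2 * suc n
    2+n≤2*[1+n] = ≤-trans (s≤s (m≤n+m (suc n) n)) (≤-reflexive (cong (suc ∘ (n +_)) (sym (+-identityʳ (suc n)))))

≤3*⌊n/2⌋ : ∀ n → 2 ≤ n → n ≤ 3 * ⌊ n /2⌋
≤3*⌊n/2⌋ 1 (s≤s ())
≤3*⌊n/2⌋ 2 _ = s≤s (s≤s z≤n)
≤3*⌊n/2⌋ 3 _ = ≤-refl
≤3*⌊n/2⌋ (suc (suc n@(suc (suc _)))) _ =
  ≤-trans (s≤s (s≤s (m≤n⇒m≤1+n (≤3*⌊n/2⌋ n (s≤s (s≤s z≤n)))))) (≤-reflexive (sym (*-suc 3 ⌊ n /2⌋)))

hunt-time-bound : ∀ b {D m k} → D ≤ 3 * m → D ≤ k → m * ⌊log₂ (suc b) ⌋ ≤ k → D * ⌊log₂ (suc (suc b)) ⌋ ≤ 4 * k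
hunt-time-bound b {D} {m} {k} D≤3m D≤k bits≤k = begin
  D * ⌊log₂ (suc (suc b)) ⌋ ≤⟨ *-monoʳ-≤ D (⌊log₂[2+n]⌋≤1+⌊log₂[1+n]⌋ b) ⟩
  D * suc L               ≡⟨ *-suc D L ⟩
  D + D * L               ≤⟨ +-mono-≤ D≤k (*-monoˡ-≤ L D≤3m) ⟩
  k + 3 * m * L           ≡⟨ cong (k +_) (*-assoc 3 m L) ⟩
  k + 3 * (m * L)         ≤⟨ +-monoʳ-≤ k (*-monoʳ-≤ 3 bits≤k) ⟩
  4 * k                   ∎
  where
    open ≤-Reasoning
    L = ⌊log₂ (suc b) ⌋

HuntLowerBound : ℕ → ℕ → ℕ → Set
HuntLowerBound c Δ D =
  Σ PGraph λ G → MaxDegree G Δ × Diameter G D ×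
    Σ (Node G) λ s → (A : Algorithm) (P : PebbleStrategy G) →
      Σ (Node G) λ t → Dist G s t D ×
        ((k : ℕ) (h : List Obs) → run G s t (P t) A k ≡ just (t , h) → D * ⌊log₂ Δ ⌋ ≤ c * k)

broom-lower-bound : ∀ b p m → 1 ≤ m → m ≤ p → p + m ≤ 3 * m → HuntLowerBound 4 (suc (suc b)) (p + m)
broom-lower-bound b p m 1≤m m≤p H≤3m =
  G , (degree-bound (s≤s z≤n) , node handle-end , degree-handle-end (≤-trans 1≤m m≤p) 1≤m) ,
  (walk-any m≤p , node start , node (leaf some-leaf) , dist-start (leaf some-leaf) refl) ,
  node start , slowest
  where
    open Broom (suc b) p m
    some-leaf : Fin (#addresses H)
    some-leaf = subst Fin (sym (#addresses-head m ≤-refl)) (F.fromℕ< (m^n>0 (suc b) m))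
    slowest : (A : Algorithm) (P : PebbleStrategy G) →
      Σ (Node G) λ t → Dist G (node start) t H ×
        ((k : ℕ) (h : List Obs) → run G (node start) t (P t) A k ≡ just (t , h) → H * ⌊log₂ (suc (suc b)) ⌋ ≤ 4 * k)
    slowest A P with slow-leaf (m * ⌊log₂ (suc b) ⌋) (2^[m*⌊log₂b⌋]≤b^m (suc b) m (s≤s z≤n)) A P
    ... | i , slow = node (leaf i) , dist-start (leaf i) refl , λ k h arr →
      let H≤k , bits≤k = slow k h arr in hunt-time-bound b {m = m} H≤3m H≤k bits≤k

mainTheorem3 :
    Σ ℕ λ c →
      (Δ D : ℕ) → 2 ≤ Δ → 3 ≤ D →
      Σ PGraph λ G → MaxDegree G Δ × Diameter G D ×
        Σ (Node G) λ s →
          (A : Algorithm) (P : PebbleStrategy G) →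
            Σ (Node G) λ t → Dist G s t D ×
              ((k : ℕ) (h : List Obs) → run G s t (P t) A k ≡ just (t , h) →
                D * ⌊log₂ Δ ⌋ ≤ c * k)
mainTheorem3 = 4 , bound
  where
    bound : ∀ Δ D → 2 ≤ Δ → 3 ≤ D → HuntLowerBound 4 Δ D
    bound (suc (suc b)) D (s≤s (s≤s z≤n)) 3≤D = subst (HuntLowerBound 4 (suc (suc b))) p+m≡D
      (broom-lower-bound b p m (⌊n/2⌋-mono 2≤D) (⌊n/2⌋≤⌈n/2⌉ D) (subst (_≤ 3 * m) (sym p+m≡D) (≤3*⌊n/2⌋ D 2≤D)))
      where
        m = ⌊ D /2⌋
        p = ⌈ D /2⌉
        2≤D : 2 ≤ D
        2≤D = ≤-trans (n≤1+n 2) 3≤D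
        p+m≡D : p + m ≡ D
        p+m≡D = trans (+-comm p m) (⌊n/2⌋+⌈n/2⌉≡n D)
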